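{- Let $(\mathcal{M},\omega)$ be a proper pair, where $\mathcal{M}$ is an $n$-maniplex and $\omega\colon E(\mathcal{M})\to\mathbb{Z}_4$, and let $\mathcal{C}$ be an $\mathrm{Aut}(\mathcal{M})$-invariant $\ell$-colouring of $\mathcal{M}$. If $\mathcal{M}^\omega$ has symmetry type $2^n_I$, then $(2^{(\mathcal{M},\mathcal{C})})^{\omega_\mathcal{C}}$ is a maniplex with symmetry type $2^{n+1}_{I\cup\{n\}}$.
   Context: An $n$-maniplex is a connected $n$-valent simple graph with a proper edge-colouring by $\{0,\dots,n-1\}$ such that whenever $|i-j|>1$ the edges of colours $i,j$ form a disjoint union of $4$-cycles; vertices are flags, $u^i$ is the $i$-neighbour of $u$; automorphisms are colour-preserving graph automorphisms; regular means $\mathrm{Aut}$ is transitive on flags; non-orientable means non-bipartite. A $2$-orbit $n$-maniplex has symmetry type $2^n_I$, where $I\subseteq\{0,\dots,n-1\}$ is the set of colours $i$ such that each flag lies in the same $\mathrm{Aut}$-orbit as its $i$-neighbour (equivalently, $I$ is the set of colours of semi-edges in the quotient of the maniplex by its automorphism group). Facets are the components after deleting the edges of colour $n-1$. An $\ell$-colouring is a surjection $\mathcal{C}$ from facets to $\{1,\dots,\ell\}$ (flags get their facet's colour); it is $\mathrm{Aut}(\mathcal{M})$-invariant if for each $\varphi\in\mathrm{Aut}(\mathcal{M})$, $\mathcal{C}(F)\mapsto\mathcal{C}(F\varphi)$ is a well-defined bijection of colours. The colour-coded extension $2^{(\mathcal{M},\mathcal{C})}$ is the $(n+1)$-maniplex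 with flag set $\mathcal{F}\times\mathbb{Z}_2^\ell$, with $(u,x)^i=(u^i,x)$ for $i<n$ and $(u,x)^n=(u,x^j)$, $j$ the colour of $u$, $x^j$ differing from $x$ only in coordinate $j$. With $\sigma(x)=(-1)^{\#\{\text{coordinates }=1\}}$, the weight $\omega_\mathcal{C}$ assigns $\sigma(x)\omega(uu^i)$ to the $i$-edge joining $(u,x),(u^i,x)$ for $i<n$, and $0$ to $n$-edges. For a weight $\omega\colon E(\Gamma)\to\mathbb{Z}_k$, the cross-cover $\Gamma^\omega$ has vertex set $V(\Gamma)\times\mathbb{Z}_k$ with $(u,i)$ adjacent to $(v,\omega(e)-i)$ for each edge $e=uv$, the new edge receiving the colour of $e$; $\pi(u,i)=u$. For a walk $W$ with edges $e_0,\dots,e_{m-1}$, $\omega(W)=\sum_j(-1)^j\omega(e_j)$. An automorphism $\varphi$ of $\mathcal{M}$ lifts if there is an automorphism $\bar\varphi$ of $\mathcal{M}^\omega$ with $\pi(y\bar\varphi)=\pi(y)\varphi$; $\omega$ is $\mathrm{Aut}(\mathcal{M})$-consistent if every automorphism lifts. $(\mathcal{M},\omega)$ is a proper pair if (1) $\mathcal{M}$ is regular, (2) $\mathcal{M}$ has a closed walk $W$ of odd length with $\omega(W)$ even, (3) $\mathcal{M}^\omega$ is a non-orientable maniplex, (4) $\omega$ is $\mathrm{Aut}(\mathcal{M})$-consistent. -}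

module Defs where

open import Data.Nat using (ℕ; zero; suc; _+_; _∸_; _<_; NonZero)
open import Data.Nat.DivMod using (_mod_)
open import Data.Nat.Divisibility using (_∣_)
open import Data.Fin using (Fin; toℕ; fromℕ; inject₁)
open import Data.Fin.Subset using (Subset; _∈_)
open import Data.Vec using (Vec; []; _∷_; updateAt; _∷ʳ_)
open import Data.List using (List; []; _∷_; length)
open import Data.Bool using (Bool; true; false; not)
open import Data.Product using (Σ; ∃; _×_; _,_; proj₁)
open import Data.Sum using (_⊎_)
open import Relation.Nullary using (¬_)
open import Relation.Binary.PropositionalEquality using (_≡_; _≢_)
open import Function.Bundles using (_↔_; Inverse)

Zmod : ℕ → Set
Zmod k = Fin k

module _ {k : ℕ} .{{_ : NonZero k}} where
  0ₖ : Zmod k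
  0ₖ = 0 mod k

  _+ₖ_ : Zmod k → Zmod k → Zmod k
  a +ₖ b = (toℕ a + toℕ b) mod k

  -ₖ_ : Zmod k → Zmod k
  -ₖ a = (k ∸ toℕ a) mod k

  _-ₖ_ : Zmod k → Zmod k → Zmod k
  a -ₖ b = a +ₖ (-ₖ b)

-- Edge-coloured n-valent graphs, given by their colour-i neighbour maps
-- (u ^ i is the i-neighbour u^i of the flag u).

record Graph (n : ℕ) : Set₁ where
  field
    Flag : Set
    _^_  : Flag → Fin n → Flag

open Graph public

_^*_ : ∀ {n} {G : Graph n} → Flag G → List (Fin n) → Flag G
_^*_ {G = G} u []       = u
_^*_ {G = G} u (i ∷ is) = _^*_ {G = G} (_^_ G u i) is

Far : ∀ {n} → Fin n → Fin n → Set
Far i j = (suc (toℕ i) < toℕ j) ⊎ (suc (toℕ j) < toℕ i)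

record IsManiplex {n : ℕ} (G : Graph n) : Set where
  private
    F = Flag G
    _⁀_ = _^_ G
  field
    involutive : ∀ i (u : F) → (u ⁀ i) ⁀ i ≡ u
    noLoop     : ∀ i (u : F) → u ⁀ i ≢ u
    simple     : ∀ i j (u : F) → i ≢ j → u ⁀ i ≢ u ⁀ j
    fourCycles : ∀ i j (u : F) → Far i j → (((u ⁀ i) ⁀ j) ⁀ i) ⁀ j ≡ u
    connected  : ∀ (u v : F) → ∃ λ (w : List (Fin n)) → _^*_ {G = G} u w ≡ v

record Aut {n : ℕ} (G : Graph n) : Set where
  field
    fun      : Flag G → Flag G
    inv      : Flag G → Flag G
    left     : ∀ u → inv (fun u) ≡ u
    right    : ∀ u → fun (inv u) ≡ u
    preserve : ∀ i u → fun (_^_ G u i) ≡ _^_ G (fun u) i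

open Aut public

SameOrbit : ∀ {n} (G : Graph n) → Flag G → Flag G → Set
SameOrbit G u v = ∃ λ (φ : Aut G) → fun φ u ≡ v

Regular : ∀ {n} (G : Graph n) → Set
Regular G = ∀ u v → SameOrbit G u v

Bipartite : ∀ {n} (G : Graph n) → Set
Bipartite G = ∃ λ (b : Flag G → Bool) → ∀ i u → b (_^_ G u i) ≢ b u

NonOrientable : ∀ {n} (G : Graph n) → Set
NonOrientable G = ¬ Bipartite G

TwoOrbit : ∀ {n} (G : Graph n) → Set
TwoOrbit G = ∃ λ u → ∃ λ v → ¬ SameOrbit G u v
             × (∀ w → SameOrbit G w u ⊎ SameOrbit G w v)

HasSymType2 : ∀ {n} (G : Graph n) → Subset n → Set
HasSymType2 {n} G I =
  TwoOrbit G × (∀ (i : Fin n) → (i ∈ I → ∀ u → SameOrbit G u (_^_ G u i))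
                               × ((∀ u → SameOrbit G u (_^_ G u i)) → i ∈ I))

-- Weights ω : E(G) → ℤ_k.  The i-edge {u, u^i} gets weight w i u;
-- IsWeight says this is well defined on the (unordered) edge.

RawWeight : ∀ {n} (G : Graph n) → ℕ → Set
RawWeight {n} G k = Fin n → Flag G → Zmod k

IsWeight : ∀ {n k} (G : Graph n) → RawWeight G k → Set
IsWeight {n} G w = ∀ i u → w i (_^_ G u i) ≡ w i u

CrossCover : ∀ {n k} .{{_ : NonZero k}} (G : Graph n) → RawWeight G k → Graph n
CrossCover {n} {k} G w = record
  { Flag = Flag G × Zmod k
  ; _^_  = λ { (u , a) i → (_^_ G u i , (w i u -ₖ a)) } }

-- ω(W) = Σ (-1)^j ω(e_j) for the walk from u along colours is
altSum : ∀ {n k} .{{_ : NonZero k}} (G : Graph n) → RawWeight G k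
         → Flag G → List (Fin n) → Zmod k
altSum G w u []       = 0ₖ
altSum G w u (i ∷ is) = w i u -ₖ altSum G w (_^_ G u i) is

Consistent : ∀ {n k} .{{_ : NonZero k}} (G : Graph n) → RawWeight G k → Set
Consistent G w = ∀ (φ : Aut G) → ∃ λ (ψ : Aut (CrossCover G w)) →
                   ∀ y → proj₁ (fun ψ y) ≡ fun φ (proj₁ y)

ProperPair : ∀ {n} (G : Graph n) → RawWeight G 4 → Set
ProperPair {n} G w =
    Regular G
  × (∃ λ u → ∃ λ (W : List (Fin n)) → (_^*_ {G = G} u W ≡ u)
       × ¬ (2 ∣ length W) × (2 ∣ toℕ (altSum G w u W)))
  × (IsManiplex (CrossCover G w) × NonOrientable (CrossCover G w))
  × Consistent G w

-- ℓ-colourings: a colour for each flag, constant on facets (invariant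
-- under i-neighbours for i ≠ n-1), surjective onto the ℓ colours.

record Colouring {n : ℕ} (G : Graph n) (ℓ : ℕ) : Set where
  field
    col      : Flag G → Fin ℓ
    onFacets : ∀ (i : Fin n) u → suc (toℕ i) < n → col (_^_ G u i) ≡ col u
    onto     : ∀ (j : Fin ℓ) → ∃ λ u → col u ≡ j

open Colouring public

AutInvariant : ∀ {n ℓ} (G : Graph n) → Colouring G ℓ → Set
AutInvariant {ℓ = ℓ} G C = ∀ (φ : Aut G) → ∃ λ (π : Fin ℓ ↔ Fin ℓ) →
  ∀ u → col C (fun φ u) ≡ Inverse.to π (col C u)

-- caseLast i f a = f j if i = inject₁ j, and a if i = fromℕ n
caseLast : ∀ {n} {A : Set} → Fin (suc n) → (Fin n → A) → A → A
caseLast {zero}  Fin.zero    f a = a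
caseLast {suc n} Fin.zero    f a = f Fin.zero
caseLast {suc n} (Fin.suc i) f a = caseLast {n} i (λ j → f (Fin.suc j)) a

flipAt : ∀ {ℓ} → Fin ℓ → Vec Bool ℓ → Vec Bool ℓ
flipAt j x = updateAt x j not

signed : ∀ {ℓ k} .{{_ : NonZero k}} → Vec Bool ℓ → Zmod k → Zmod k
signed []          a = a
signed (true ∷ x)  a = -ₖ (signed x a)
signed (false ∷ x) a = signed x a

Ext : ∀ {n ℓ} (G : Graph n) → Colouring G ℓ → Graph (suc n)
Ext {n} {ℓ} G C = record
  { Flag = Flag G × Vec Bool ℓ
  ; _^_  = λ { (u , x) i → caseLast i (λ j → (_^_ G u j , x)) (u , flipAt (col C u) x) } }

weightC : ∀ {n ℓ k} .{{_ : NonZero k}} (G : Graph n) (C : Colouring G ℓ)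
          → RawWeight G k → RawWeight (Ext G C) k
weightC G C w i (u , x) = caseLast i (λ j → signed x (w j u)) 0ₖ

addTop : ∀ {n} → Subset n → Subset (suc n)
addTop I = I ∷ʳ true

{-# OPTIONS --safe #-}
-- The map ((u , x) , a) ↦ ((u , σ(x) a) , x) identifies (2^(M,C))^(ω_C) with the colour-coded
-- extension 2^(M^ω, C ∘ π) of the cross-cover, so everything reduces to extensions 2^(G,C) of a
-- maniplex G. Such an extension is again a maniplex. Its automorphisms map layers G × {x} onto
-- layers and so restrict to G; conversely, automorphisms of G that permute the colours lift, and
-- flipping one coordinate of x is an automorphism. Hence (u , x) and (v , y) lie in one orbit
-- exactly when u and v do, provided the orbits of G are realised by colour-permuting
-- automorphisms. This holds for G = M^ω: by regularity and consistency, two flags in one orbit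
-- differ by a lift of an automorphism of M up to the half-turn a ↦ a + 2 of ℤ₄; the remaining
-- case, an odd shift inside a fibre, would make M^ω flag-transitive.

module Submission where

open import Defs
open import Data.Nat using (ℕ; suc; _<_; NonZero)
open import Data.Nat.DivMod using (_mod_)
open import Data.Nat.Properties using (<-asym; <-trans; n<1+n)
open import Data.Fin using (Fin; toℕ; fromℕ; inject₁; _≟_) renaming (zero to fzero; suc to fsuc)
open import Data.Fin.Properties using (all?; toℕ-inject₁; toℕ-fromℕ; toℕ<n)
open import Data.Fin.Subset using (Subset; _∈_)
open import Data.Vec using (Vec; []; _∷_; lookup; tabulate; replicate; here; there)
open import Data.Vec.Properties
  using (updateAt-updateAt-local; updateAt-id; updateAt-commutes; lookup∘updateAt; lookup∘updateAt′;
         lookup∘tabulate; tabulate∘lookup; tabulate-cong)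
open import Data.List using (List; []; _∷_; map; _++_)
open import Data.Bool using (Bool; true; false; not)
open import Data.Bool.Properties using (not-involutive; not-¬)
open import Data.Product using (∃; ∃₂; _×_; _,_; proj₁; proj₂)
open import Data.Sum using (_⊎_; inj₁; inj₂)
import Data.Sum as Sum
open import Data.Unit using (tt)
open import Data.Empty using (⊥-elim)
open import Function using (_∘_)
open import Function.Bundles using (_↔_; Inverse; mk↔ₛ′)
open import Function.Construct.Symmetry using (↔-sym)
open import Relation.Nullary using (¬_; yes; no)
open import Relation.Nullary.Decidable using (toWitness; _⊎-dec_; _→-dec_)
open import Relation.Binary.PropositionalEquality
open ≡-Reasoning

ℤ₄ : Set
ℤ₄ = Zmod 4

half : ℤ₄
half = 2 mod 4

neg-involutive : ∀ (a : ℤ₄) → -ₖ (-ₖ a) ≡ a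
neg-involutive = toWitness {a? = all? λ a → -ₖ (-ₖ a) ≟ a} tt

neg-distrib-sub : ∀ (a b : ℤ₄) → -ₖ (a -ₖ b) ≡ (-ₖ a) -ₖ (-ₖ b)
neg-distrib-sub = toWitness {a? = all? λ a → all? λ b → -ₖ (a -ₖ b) ≟ (-ₖ a) -ₖ (-ₖ b)} tt

zero-sub : ∀ (a : ℤ₄) → 0ₖ -ₖ a ≡ -ₖ a
zero-sub = toWitness {a? = all? λ a → 0ₖ -ₖ a ≟ -ₖ a} tt

+half-involutive : ∀ (a : ℤ₄) → (a +ₖ half) +ₖ half ≡ a
+half-involutive = toWitness {a? = all? λ a → (a +ₖ half) +ₖ half ≟ a} tt

sub-+half : ∀ (w a : ℤ₄) → w -ₖ (a +ₖ half) ≡ (w -ₖ a) +ₖ half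
sub-+half = toWitness {a? = all? λ w → all? λ a → w -ₖ (a +ₖ half) ≟ (w -ₖ a) +ₖ half} tt

OddApart : ℤ₄ → ℤ₄ → Set
OddApart b c = c ≡ b +ₖ (1 mod 4) ⊎ c ≡ b +ₖ (3 mod 4)

parity-cases : ∀ (b c : ℤ₄) → c ≡ b ⊎ c +ₖ half ≡ b ⊎ OddApart b c
parity-cases = toWitness {a? = all? λ b → all? λ c →
  (c ≟ b) ⊎-dec (c +ₖ half ≟ b) ⊎-dec (c ≟ b +ₖ (1 mod 4)) ⊎-dec (c ≟ b +ₖ (3 mod 4))} tt

oddApart-cover : ∀ (b c : ℤ₄) → OddApart b c →
                 ∀ d → d ≡ b ⊎ d ≡ b +ₖ half ⊎ d ≡ c ⊎ d ≡ c +ₖ half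
oddApart-cover = toWitness {a? = all? λ b → all? λ c →
  ((c ≟ b +ₖ (1 mod 4)) ⊎-dec (c ≟ b +ₖ (3 mod 4))) →-dec
  all? λ d → (d ≟ b) ⊎-dec (d ≟ b +ₖ half) ⊎-dec (d ≟ c) ⊎-dec (d ≟ c +ₖ half)} tt

signed-dichotomy : ∀ {ℓ} (x : Vec Bool ℓ) →
                   (∀ (a : ℤ₄) → signed x a ≡ a) ⊎ (∀ (a : ℤ₄) → signed x a ≡ -ₖ a)
signed-dichotomy []          = inj₁ λ _ → refl
signed-dichotomy (false ∷ x) = signed-dichotomy x
signed-dichotomy (true ∷ x)  with signed-dichotomy x
... | inj₁ plus  = inj₂ λ a → cong -ₖ_ (plus a)
... | inj₂ minus = inj₁ λ a → trans (cong -ₖ_ (minus a)) (neg-involutive a)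

signed-involutive : ∀ {ℓ} (x : Vec Bool ℓ) (a : ℤ₄) → signed x (signed x a) ≡ a
signed-involutive x a with signed-dichotomy x
... | inj₁ plus  = trans (plus _) (plus a)
... | inj₂ minus = trans (minus _) (trans (cong -ₖ_ (minus a)) (neg-involutive a))

signed-sub : ∀ {ℓ} (x : Vec Bool ℓ) (a b : ℤ₄) → signed x (a -ₖ b) ≡ signed x a -ₖ signed x b
signed-sub x a b with signed-dichotomy x
... | inj₁ plus  = trans (plus _) (sym (cong₂ _-ₖ_ (plus a) (plus b)))
... | inj₂ minus = trans (minus _) (trans (neg-distrib-sub a b) (sym (cong₂ _-ₖ_ (minus a) (minus b))))

signed-neg : ∀ {ℓ} (x : Vec Bool ℓ) (a : ℤ₄) → signed x (-ₖ a) ≡ -ₖ signed x a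
signed-neg x a with signed-dichotomy x
... | inj₁ plus  = trans (plus _) (sym (cong -ₖ_ (plus a)))
... | inj₂ minus = trans (minus _) (sym (cong -ₖ_ (minus a)))

signed-flipAt : ∀ {ℓ} (j : Fin ℓ) (x : Vec Bool ℓ) (a : ℤ₄) → signed (flipAt j x) a ≡ -ₖ signed x a
signed-flipAt fzero    (true ∷ x)  a = sym (neg-involutive _)
signed-flipAt fzero    (false ∷ x) a = refl
signed-flipAt (fsuc j) (true ∷ x)  a = cong -ₖ_ (signed-flipAt j x a)
signed-flipAt (fsuc j) (false ∷ x) a = signed-flipAt j x a

flipAt-involutive : ∀ {ℓ} (j : Fin ℓ) (x : Vec Bool ℓ) → flipAt j (flipAt j x) ≡ x
flipAt-involutive j x =
  trans (updateAt-updateAt-local j {h = λ b → b} x (not-involutive (lookup x j))) (updateAt-id j x)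

flipAt-comm : ∀ {ℓ} (i j : Fin ℓ) (x : Vec Bool ℓ) → flipAt i (flipAt j x) ≡ flipAt j (flipAt i x)
flipAt-comm i j x with i ≟ j
... | yes refl = refl
... | no  i≢j  = updateAt-commutes i j i≢j x

flipAt-≢ : ∀ {ℓ} (j : Fin ℓ) (x : Vec Bool ℓ) → flipAt j x ≢ x
flipAt-≢ j x eq = not-¬ refl (sym (trans (sym (lookup∘updateAt j x)) (cong (λ v → lookup v j) eq)))

flipAt-connected : ∀ {ℓ} (R : Vec Bool ℓ → Vec Bool ℓ → Set) →
                   (∀ x → R x x) → (∀ {x y z} → R x y → R y z → R x z) →
                   (∀ j x → R x (flipAt j x)) → ∀ x y → R x y
flipAt-connected R refl′ trans′ flip [] [] = refl′ []
flipAt-connected R refl′ trans′ flip (b ∷ x) (c ∷ y) =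
  trans′ (flipAt-connected (λ x y → R (b ∷ x) (b ∷ y)) (λ _ → refl′ _) trans′
                            (λ j x → flip (fsuc j) (b ∷ x)) x y)
         (head b c)
  where
    head : ∀ b c → R (b ∷ y) (c ∷ y)
    head false false = refl′ _
    head true  true  = refl′ _
    head false true  = flip fzero (false ∷ y)
    head true  false = flip fzero (true ∷ y)

permute : ∀ {ℓ} {A : Set} → Fin ℓ ↔ Fin ℓ → Vec A ℓ → Vec A ℓ
permute π x = tabulate (lookup x ∘ Inverse.from π)

≡-by-lookup : ∀ {ℓ} {A : Set} {x y : Vec A ℓ} → (∀ k → lookup x k ≡ lookup y k) → x ≡ y
≡-by-lookup {x = x} {y} eq = trans (sym (tabulate∘lookup x)) (trans (tabulate-cong eq) (tabulate∘lookup y))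

permute-inverse : ∀ {ℓ} {A : Set} (π : Fin ℓ ↔ Fin ℓ) (x : Vec A ℓ) →
                  permute (↔-sym π) (permute π x) ≡ x
permute-inverse π x = ≡-by-lookup λ k → begin
  lookup (permute (↔-sym π) (permute π x)) k  ≡⟨ lookup∘tabulate _ k ⟩
  lookup (permute π x) (Inverse.to π k)       ≡⟨ lookup∘tabulate (lookup x ∘ Inverse.from π) (Inverse.to π k) ⟩
  lookup x (Inverse.from π (Inverse.to π k))  ≡⟨ cong (lookup x) (Inverse.strictlyInverseʳ π k) ⟩
  lookup x k                                  ∎

permute-flipAt : ∀ {ℓ} (π : Fin ℓ ↔ Fin ℓ) (c : Fin ℓ) (x : Vec Bool ℓ) →
                 permute π (flipAt c x) ≡ flipAt (Inverse.to π c) (permute π x)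
permute-flipAt π c x = ≡-by-lookup λ k → trans (lookup∘tabulate _ k) (at k)
  where
    open Inverse π using (to; from; strictlyInverseˡ; strictlyInverseʳ)
    at : ∀ k → lookup (flipAt c x) (from k) ≡ lookup (flipAt (to c) (permute π x)) k
    at k with k ≟ to c
    ... | yes refl = begin
      lookup (flipAt c x) (from (to c))        ≡⟨ cong (lookup (flipAt c x)) (strictlyInverseʳ c) ⟩
      lookup (flipAt c x) c                    ≡⟨ lookup∘updateAt c x ⟩
      not (lookup x c)                         ≡⟨ cong (not ∘ lookup x) (strictlyInverseʳ c) ⟨
      not (lookup x (from (to c)))             ≡⟨ cong not (lookup∘tabulate _ (to c)) ⟨
      not (lookup (permute π x) (to c))        ≡⟨ lookup∘updateAt (to c) (permute π x) ⟨
      lookup (flipAt (to c) (permute π x)) (to c) ∎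
    ... | no k≢tc = begin
      lookup (flipAt c x) (from k)             ≡⟨ lookup∘updateAt′ (from k) c from-k≢c x ⟩
      lookup x (from k)                        ≡⟨ lookup∘tabulate _ k ⟨
      lookup (permute π x) k                   ≡⟨ lookup∘updateAt′ k (to c) k≢tc (permute π x) ⟨
      lookup (flipAt (to c) (permute π x)) k   ∎
      where
        from-k≢c : from k ≢ c
        from-k≢c eq = k≢tc (trans (sym (strictlyInverseˡ k)) (cong to eq))

data LastView {n : ℕ} : Fin (suc n) → Set where
  below : (j : Fin n) → LastView (inject₁ j)
  last  : LastView (fromℕ n)

lastView : ∀ {n} (i : Fin (suc n)) → LastView i
lastView {ℕ.zero} fzero    = last
lastView {suc n}  fzero    = below fzero
lastView {suc n}  (fsuc i) with lastView i
... | below j = below (fsuc j)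
... | last    = last

caseLast-inject₁ : ∀ {n} {A : Set} (j : Fin n) (f : Fin n → A) (a : A) → caseLast (inject₁ j) f a ≡ f j
caseLast-inject₁ fzero    f a = refl
caseLast-inject₁ (fsuc j) f a = caseLast-inject₁ j (f ∘ fsuc) a

caseLast-fromℕ : ∀ {n} {A : Set} (f : Fin n → A) (a : A) → caseLast (fromℕ n) f a ≡ a
caseLast-fromℕ {ℕ.zero} f a = refl
caseLast-fromℕ {suc n}  f a = caseLast-fromℕ (f ∘ fsuc) a

Far-irrefl : ∀ {n} (i : Fin n) → ¬ Far i i
Far-irrefl i (inj₁ lt) = <-asym (n<1+n (toℕ i)) lt
Far-irrefl i (inj₂ lt) = <-asym (n<1+n (toℕ i)) lt

Far-sym : ∀ {n} {i j : Fin n} → Far i j → Far j i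
Far-sym = Sum.swap

Far-inject₁ : ∀ {n} (i j : Fin n) → Far (inject₁ i) (inject₁ j) → Far i j
Far-inject₁ i j far rewrite toℕ-inject₁ i | toℕ-inject₁ j = far

Far-inject₁-fromℕ : ∀ {n} (j : Fin n) → Far (inject₁ j) (fromℕ n) → suc (toℕ j) < n
Far-inject₁-fromℕ {n} j far rewrite toℕ-inject₁ j | toℕ-fromℕ n with far
... | inj₁ lt = lt
... | inj₂ lt = ⊥-elim (<-asym (toℕ<n j) (<-trans (n<1+n n) lt))

inject₁∈addTop : ∀ {n} (I : Subset n) (j : Fin n) → j ∈ I → inject₁ j ∈ addTop I
inject₁∈addTop (_ ∷ I) fzero    here      = here
inject₁∈addTop (_ ∷ I) (fsuc j) (there m) = there (inject₁∈addTop I j m)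

inject₁∈addTop⁻ : ∀ {n} (I : Subset n) (j : Fin n) → inject₁ j ∈ addTop I → j ∈ I
inject₁∈addTop⁻ (_ ∷ I) fzero    here      = here
inject₁∈addTop⁻ (_ ∷ I) (fsuc j) (there m) = there (inject₁∈addTop⁻ I j m)

fromℕ∈addTop : ∀ {n} (I : Subset n) → fromℕ n ∈ addTop I
fromℕ∈addTop []      = here
fromℕ∈addTop (_ ∷ I) = there (fromℕ∈addTop I)

walk : ∀ {n} (G : Graph n) → Flag G → List (Fin n) → Flag G
walk G = _^*_ {G = G}

walk-++ : ∀ {n} (G : Graph n) (u : Flag G) (V W : List (Fin n)) →
          walk G u (V ++ W) ≡ walk G (walk G u V) W
walk-++ G u []      W = refl
walk-++ G u (i ∷ V) W = walk-++ G (_^_ G u i) V W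

Reachable : ∀ {n} (G : Graph n) → Flag G → Flag G → Set
Reachable G u v = ∃ λ W → walk G u W ≡ v

Reachable-trans : ∀ {n} (G : Graph n) {u v w : Flag G} → Reachable G u v → Reachable G v w → Reachable G u w
Reachable-trans G {u} (V , refl) (W , refl) = V ++ W , walk-++ G u V W

record _≅_ {n} (G H : Graph n) : Set where
  field
    to      : Flag G → Flag H
    from    : Flag H → Flag G
    from∘to : ∀ u → from (to u) ≡ u
    to∘from : ∀ v → to (from v) ≡ v
    to-^    : ∀ i u → to (_^_ G u i) ≡ _^_ H (to u) i

open _≅_

≅-refl : ∀ {n} {G : Graph n} → G ≅ G
≅-refl = record { to = λ u → u ; from = λ u → u ; from∘to = λ _ → refl ; to∘from = λ _ → refl
                ; to-^ = λ _ _ → refl }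

≅-sym : ∀ {n} {G H : Graph n} → G ≅ H → H ≅ G
≅-sym {G = G} {H} h = record
  { to = from h ; from = to h ; from∘to = to∘from h ; to∘from = from∘to h ; to-^ = from-^ }
  where
    from-^ : ∀ i v → from h (_^_ H v i) ≡ _^_ G (from h v) i
    from-^ i v = begin
      from h (_^_ H v i)                  ≡⟨ cong (λ w → from h (_^_ H w i)) (to∘from h v) ⟨
      from h (_^_ H (to h (from h v)) i)  ≡⟨ cong (from h) (to-^ h i (from h v)) ⟨
      from h (to h (_^_ G (from h v) i))  ≡⟨ from∘to h _ ⟩
      _^_ G (from h v) i                  ∎

≅-trans : ∀ {n} {G H K : Graph n} → G ≅ H → H ≅ K → G ≅ K
≅-trans {H = H} g h = record
  { to      = to h ∘ to g
  ; from    = from g ∘ from h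
  ; from∘to = λ u → trans (cong (from g) (from∘to h (to g u))) (from∘to g u)
  ; to∘from = λ w → trans (cong (to h) (to∘from g (from h w))) (to∘from h w)
  ; to-^    = λ i u → trans (cong (to h) (to-^ g i u)) (to-^ h i (to g u)) }

Aut→≅ : ∀ {n} {G : Graph n} → Aut G → G ≅ G
Aut→≅ φ = record { to = fun φ ; from = inv φ ; from∘to = left φ ; to∘from = right φ ; to-^ = preserve φ }

≅→Aut : ∀ {n} {G : Graph n} → G ≅ G → Aut G
≅→Aut h = record { fun = to h ; inv = from h ; left = from∘to h ; right = to∘from h ; preserve = to-^ h }

idAut : ∀ {n} {G : Graph n} → Aut G
idAut = ≅→Aut ≅-refl

_⁻¹ : ∀ {n} {G : Graph n} → Aut G → Aut G
φ ⁻¹ = ≅→Aut (≅-sym (Aut→≅ φ))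

_⨾_ : ∀ {n} {G : Graph n} → Aut G → Aut G → Aut G
φ ⨾ ψ = ≅→Aut (≅-trans (Aut→≅ φ) (Aut→≅ ψ))

SameOrbit-refl : ∀ {n} (G : Graph n) (u : Flag G) → SameOrbit G u u
SameOrbit-refl G u = idAut , refl

SameOrbit-sym : ∀ {n} (G : Graph n) {u v : Flag G} → SameOrbit G u v → SameOrbit G v u
SameOrbit-sym G (φ , refl) = φ ⁻¹ , left φ _

SameOrbit-trans : ∀ {n} (G : Graph n) {u v w : Flag G} → SameOrbit G u v → SameOrbit G v w → SameOrbit G u w
SameOrbit-trans G (φ , refl) (ψ , refl) = φ ⨾ ψ , refl

TwoOrbit⇒¬Regular : ∀ {n} (G : Graph n) → TwoOrbit G → ¬ Regular G
TwoOrbit⇒¬Regular G (u , v , u≁v , _) regular = u≁v (regular u v)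

module _ {n} {G H : Graph n} (h : G ≅ H) where

  to-walk : ∀ u W → to h (walk G u W) ≡ walk H (to h u) W
  to-walk u []      = refl
  to-walk u (i ∷ W) = trans (to-walk (_^_ G u i) W) (cong (λ v → walk H v W) (to-^ h i u))

  walk-via-from : ∀ v W → walk H v W ≡ to h (walk G (from h v) W)
  walk-via-from v W = trans (cong (λ w → walk H w W) (sym (to∘from h v))) (sym (to-walk (from h v) W))

  ≅-closedWalk : ∀ W → (∀ u → walk G u W ≡ u) → ∀ v → walk H v W ≡ v
  ≅-closedWalk W closed v = trans (walk-via-from v W) (trans (cong (to h) (closed (from h v))) (to∘from h v))

  ≅-IsManiplex : IsManiplex G → IsManiplex H
  ≅-IsManiplex isG = record
    { involutive = λ i → ≅-closedWalk (i ∷ i ∷ []) (involutive i)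
    ; noLoop     = λ i v loop → noLoop i (from h v) (trans (sym (from-^ i v)) (cong (from h) loop))
    ; simple     = λ i j v i≢j eq → simple i j (from h v) i≢j
                     (trans (sym (from-^ i v)) (trans (cong (from h) eq) (from-^ j v)))
    ; fourCycles = λ i j v far → ≅-closedWalk (i ∷ j ∷ i ∷ j ∷ []) (λ u → fourCycles i j u far) v
    ; connected  = connected′ }
    where
      open IsManiplex isG
      from-^ : ∀ i v → from h (_^_ H v i) ≡ _^_ G (from h v) i
      from-^ = to-^ (≅-sym h)
      connected′ : ∀ v v′ → Reachable H v v′
      connected′ v v′ with connected (from h v) (from h v′)
      ... | W , reach = W , trans (walk-via-from v W) (trans (cong (to h) reach) (to∘from h v′))

  ≅-SameOrbit : ∀ {u v} → SameOrbit G u v → SameOrbit H (to h u) (to h v)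
  ≅-SameOrbit {u} (φ , refl) =
    ≅→Aut (≅-trans (≅-sym h) (≅-trans (Aut→≅ φ) h)) , cong (to h ∘ fun φ) (from∘to h u)

  ≅-neighbourOrbits : ∀ i → (∀ u → SameOrbit G u (_^_ G u i)) → ∀ v → SameOrbit H v (_^_ H v i)
  ≅-neighbourOrbits i orbits v =
    subst (λ w → SameOrbit H w (_^_ H w i)) (to∘from h v)
      (subst (SameOrbit H _) (to-^ h i (from h v)) (≅-SameOrbit (orbits (from h v))))

module _ {n} {G H : Graph n} (h : G ≅ H) where

  ≅-SameOrbit⁻ : ∀ {u v} → SameOrbit H (to h u) (to h v) → SameOrbit G u v
  ≅-SameOrbit⁻ {u} {v} s = subst₂ (SameOrbit G) (from∘to h u) (from∘to h v) (≅-SameOrbit (≅-sym h) s)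

  ≅-TwoOrbit : TwoOrbit G → TwoOrbit H
  ≅-TwoOrbit (u , v , u≁v , cover) =
    to h u , to h v , u≁v ∘ ≅-SameOrbit⁻ ,
    λ w → subst (λ w → SameOrbit H w (to h u) ⊎ SameOrbit H w (to h v)) (to∘from h w)
            (Sum.map (≅-SameOrbit h) (≅-SameOrbit h) (cover (from h w)))

  ≅-HasSymType2 : ∀ {I} → HasSymType2 G I → HasSymType2 H I
  ≅-HasSymType2 (two , types) =
    ≅-TwoOrbit two ,
    λ i → (λ i∈I → ≅-neighbourOrbits h i (proj₁ (types i) i∈I)) ,
          (λ orbits → proj₂ (types i) (≅-neighbourOrbits (≅-sym h) i orbits))

module _ {n} (G : Graph n) (involutive : ∀ i u → _^_ G (_^_ G u i) i ≡ u) where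

  private
    _^ᴳ_ : Flag G → Fin n → Flag G
    _^ᴳ_ = _^_ G

  fourCycle⇒commute : ∀ i j u → (((u ^ᴳ i) ^ᴳ j) ^ᴳ i) ^ᴳ j ≡ u → (u ^ᴳ i) ^ᴳ j ≡ (u ^ᴳ j) ^ᴳ i
  fourCycle⇒commute i j u cycle = begin
    (u ^ᴳ i) ^ᴳ j                           ≡⟨ involutive i _ ⟨
    (((u ^ᴳ i) ^ᴳ j) ^ᴳ i) ^ᴳ i             ≡⟨ cong (_^ᴳ i) (involutive j _) ⟨
    (((((u ^ᴳ i) ^ᴳ j) ^ᴳ i) ^ᴳ j) ^ᴳ j) ^ᴳ i ≡⟨ cong (λ w → (w ^ᴳ j) ^ᴳ i) cycle ⟩
    (u ^ᴳ j) ^ᴳ i                           ∎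

  commute⇒fourCycle : ∀ i j u → (u ^ᴳ i) ^ᴳ j ≡ (u ^ᴳ j) ^ᴳ i → (((u ^ᴳ i) ^ᴳ j) ^ᴳ i) ^ᴳ j ≡ u
  commute⇒fourCycle i j u comm = begin
    (((u ^ᴳ i) ^ᴳ j) ^ᴳ i) ^ᴳ j ≡⟨ cong (λ w → (w ^ᴳ i) ^ᴳ j) comm ⟩
    (((u ^ᴳ j) ^ᴳ i) ^ᴳ i) ^ᴳ j ≡⟨ cong (_^ᴳ j) (involutive i _) ⟩
    (u ^ᴳ j) ^ᴳ j               ≡⟨ involutive j u ⟩
    u                           ∎

ColourPermuting : ∀ {n ℓ} (G : Graph n) → Colouring G ℓ → Aut G → Set
ColourPermuting {ℓ = ℓ} G C ψ =
  ∃ λ (π : Fin ℓ ↔ Fin ℓ) → ∀ u → col C (fun ψ u) ≡ Inverse.to π (col C u)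

SameColourOrbit : ∀ {n ℓ} (G : Graph n) → Colouring G ℓ → Flag G → Flag G → Set
SameColourOrbit G C u v = ∃ λ ψ → ColourPermuting G C ψ × fun ψ u ≡ v

flipAt↔ : ∀ {ℓ} → Fin ℓ → Vec Bool ℓ ↔ Vec Bool ℓ
flipAt↔ j = mk↔ₛ′ (flipAt j) (flipAt j) (flipAt-involutive j) (flipAt-involutive j)

permute↔ : ∀ {ℓ} → Fin ℓ ↔ Fin ℓ → Vec Bool ℓ ↔ Vec Bool ℓ
permute↔ π = mk↔ₛ′ (permute π) (permute (↔-sym π)) (permute-inverse (↔-sym π)) (permute-inverse π)

module _ {n ℓ} {G : Graph n} (C : Colouring G ℓ) where

  private
    E : Graph (suc n)
    E = Ext G C
    _^ᴳ_ : Flag G → Fin n → Flag G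
    _^ᴳ_ = _^_ G
    _^ᴱ_ : Flag E → Fin (suc n) → Flag E
    _^ᴱ_ = _^_ E

  ^ᴱ-below : ∀ u x j → (u , x) ^ᴱ inject₁ j ≡ (u ^ᴳ j , x)
  ^ᴱ-below u x j = caseLast-inject₁ j _ _

  ^ᴱ-last : ∀ u x → (u , x) ^ᴱ fromℕ n ≡ (u , flipAt (col C u) x)
  ^ᴱ-last u x = caseLast-fromℕ {n} _ _

  base-below : ∀ y j → proj₁ (y ^ᴱ inject₁ j) ≡ proj₁ y ^ᴳ j
  base-below (u , x) j = cong proj₁ (^ᴱ-below u x j)

  layer-below : ∀ y j → proj₂ (y ^ᴱ inject₁ j) ≡ proj₂ y
  layer-below (u , x) j = cong proj₂ (^ᴱ-below u x j)

  base-last : ∀ y → proj₁ (y ^ᴱ fromℕ n) ≡ proj₁ y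
  base-last (u , x) = cong proj₁ (^ᴱ-last u x)

  ^ᴱ-below² : ∀ u x j j′ → ((u , x) ^ᴱ inject₁ j) ^ᴱ inject₁ j′ ≡ ((u ^ᴳ j) ^ᴳ j′ , x)
  ^ᴱ-below² u x j j′ = trans (cong (_^ᴱ inject₁ j′) (^ᴱ-below u x j)) (^ᴱ-below _ x j′)

  ^ᴱ-last² : ∀ u x → ((u , x) ^ᴱ fromℕ n) ^ᴱ fromℕ n ≡ (u , flipAt (col C u) (flipAt (col C u) x))
  ^ᴱ-last² u x = trans (cong (_^ᴱ fromℕ n) (^ᴱ-last u x)) (^ᴱ-last u _)

  ^ᴱ-below-last : ∀ u x j → ((u , x) ^ᴱ inject₁ j) ^ᴱ fromℕ n ≡ (u ^ᴳ j , flipAt (col C (u ^ᴳ j)) x)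
  ^ᴱ-below-last u x j = trans (cong (_^ᴱ fromℕ n) (^ᴱ-below u x j)) (^ᴱ-last _ x)

  ^ᴱ-last-below : ∀ u x j → ((u , x) ^ᴱ fromℕ n) ^ᴱ inject₁ j ≡ (u ^ᴳ j , flipAt (col C u) x)
  ^ᴱ-last-below u x j = trans (cong (_^ᴱ inject₁ j) (^ᴱ-last u x)) (^ᴱ-below u _ j)

  walk-below : ∀ u x W → walk E (u , x) (map inject₁ W) ≡ (walk G u W , x)
  walk-below u x []      = refl
  walk-below u x (j ∷ W) = trans (cong (λ y → walk E y (map inject₁ W)) (^ᴱ-below u x j)) (walk-below _ x W)

  Ext-IsManiplex : IsManiplex G → IsManiplex E
  Ext-IsManiplex isG = record
    { involutive = involutiveᴱ
    ; noLoop     = noLoopᴱ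
    ; simple     = simpleᴱ
    ; fourCycles = λ i i′ y far → commute⇒fourCycle E involutiveᴱ i i′ y (commuteᴱ i i′ y far)
    ; connected  = λ y y′ → reach (proj₂ y) (proj₂ y′) (proj₁ y) (proj₁ y′) }
    where
      open IsManiplex isG

      involutiveᴱ : ∀ i y → (y ^ᴱ i) ^ᴱ i ≡ y
      involutiveᴱ i (u , x) with lastView i
      ... | below j = trans (^ᴱ-below² u x j j) (cong (_, x) (involutive j u))
      ... | last    = trans (^ᴱ-last² u x) (cong (u ,_) (flipAt-involutive (col C u) x))

      noLoopᴱ : ∀ i y → y ^ᴱ i ≢ y
      noLoopᴱ i (u , x) loop with lastView i
      ... | below j = noLoop j u (trans (sym (base-below (u , x) j)) (cong proj₁ loop))
      ... | last    = flipAt-≢ (col C u) x (cong proj₂ (trans (sym (^ᴱ-last u x)) loop))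

      simpleᴱ : ∀ i i′ y → i ≢ i′ → y ^ᴱ i ≢ y ^ᴱ i′
      simpleᴱ i i′ y i≢i′ eq with lastView i | lastView i′ | cong proj₁ eq
      ... | below j | below j′ | eq₁ =
        simple j j′ (proj₁ y) (i≢i′ ∘ cong inject₁)
          (trans (sym (base-below y j)) (trans eq₁ (base-below y j′)))
      ... | below j | last     | eq₁ =
        noLoop j (proj₁ y) (trans (sym (base-below y j)) (trans eq₁ (base-last y)))
      ... | last    | below j′ | eq₁ =
        noLoop j′ (proj₁ y) (trans (sym (base-below y j′)) (trans (sym eq₁) (base-last y)))
      ... | last    | last     | _   = i≢i′ refl

      facetCommute : ∀ j y → suc (toℕ j) < n →
                     (y ^ᴱ inject₁ j) ^ᴱ fromℕ n ≡ (y ^ᴱ fromℕ n) ^ᴱ inject₁ j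
      facetCommute j (u , x) lt = begin
        ((u , x) ^ᴱ inject₁ j) ^ᴱ fromℕ n   ≡⟨ ^ᴱ-below-last u x j ⟩
        (u ^ᴳ j , flipAt (col C (u ^ᴳ j)) x) ≡⟨ cong (λ c → (u ^ᴳ j , flipAt c x)) (onFacets C j u lt) ⟩
        (u ^ᴳ j , flipAt (col C u) x)        ≡⟨ ^ᴱ-last-below u x j ⟨
        ((u , x) ^ᴱ fromℕ n) ^ᴱ inject₁ j   ∎

      commuteᴱ : ∀ i i′ y → Far i i′ → (y ^ᴱ i) ^ᴱ i′ ≡ (y ^ᴱ i′) ^ᴱ i
      commuteᴱ i i′ (u , x) far with lastView i | lastView i′
      ... | below j | below j′ = begin
        ((u , x) ^ᴱ inject₁ j) ^ᴱ inject₁ j′ ≡⟨ ^ᴱ-below² u x j j′ ⟩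
        ((u ^ᴳ j) ^ᴳ j′ , x)                 ≡⟨ cong (_, x) (fourCycle⇒commute G involutive j j′ u
                                                   (fourCycles j j′ u (Far-inject₁ j j′ far))) ⟩
        ((u ^ᴳ j′) ^ᴳ j , x)                 ≡⟨ ^ᴱ-below² u x j′ j ⟨
        ((u , x) ^ᴱ inject₁ j′) ^ᴱ inject₁ j ∎
      ... | below j | last     = facetCommute j (u , x) (Far-inject₁-fromℕ j far)
      ... | last    | below j′ = sym (facetCommute j′ (u , x) (Far-inject₁-fromℕ j′ (Far-sym far)))
      ... | last    | last     = ⊥-elim (Far-irrefl _ far)

      reachWithinLayer : ∀ x u v → Reachable E (u , x) (v , x)
      reachWithinLayer x u v with connected u v
      ... | W , reach = map inject₁ W , trans (walk-below u x W) (cong (_, x) reach)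

      reachFlip : ∀ j x u v → Reachable E (u , x) (v , flipAt j x)
      reachFlip j x u v with onto C j
      ... | w , refl =
        Reachable-trans E (reachWithinLayer x u w)
          (Reachable-trans E (fromℕ n ∷ [] , ^ᴱ-last w x) (reachWithinLayer (flipAt (col C w) x) w v))

      reach : ∀ x x′ u v → Reachable E (u , x) (v , x′)
      reach = flipAt-connected (λ x x′ → ∀ u v → Reachable E (u , x) (v , x′))
                reachWithinLayer (λ r r′ u v → Reachable-trans E (r u u) (r′ u v)) reachFlip

  liftAut : (ψ : Aut G) (X : Vec Bool ℓ ↔ Vec Bool ℓ) →
            (∀ u x → Inverse.to X (flipAt (col C u) x) ≡ flipAt (col C (fun ψ u)) (Inverse.to X x)) →
            Aut E
  liftAut ψ X compat = record
    { fun      = Φ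
    ; inv      = λ y → inv ψ (proj₁ y) , Inverse.from X (proj₂ y)
    ; left     = λ y → cong₂ _,_ (left ψ (proj₁ y)) (Inverse.strictlyInverseʳ X (proj₂ y))
    ; right    = λ y → cong₂ _,_ (right ψ (proj₁ y)) (Inverse.strictlyInverseˡ X (proj₂ y))
    ; preserve = preserveΦ }
    where
      Φ : Flag E → Flag E
      Φ y = fun ψ (proj₁ y) , Inverse.to X (proj₂ y)

      preserveΦ : ∀ i y → Φ (y ^ᴱ i) ≡ Φ y ^ᴱ i
      preserveΦ i (u , x) with lastView i
      ... | below j = begin
        Φ ((u , x) ^ᴱ inject₁ j)            ≡⟨ cong Φ (^ᴱ-below u x j) ⟩
        fun ψ (u ^ᴳ j) , Inverse.to X x     ≡⟨ cong (_, Inverse.to X x) (preserve ψ j u) ⟩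
        fun ψ u ^ᴳ j , Inverse.to X x       ≡⟨ ^ᴱ-below _ _ j ⟨
        Φ (u , x) ^ᴱ inject₁ j              ∎
      ... | last = begin
        Φ ((u , x) ^ᴱ fromℕ n)                                  ≡⟨ cong Φ (^ᴱ-last u x) ⟩
        fun ψ u , Inverse.to X (flipAt (col C u) x)             ≡⟨ cong (fun ψ u ,_) (compat u x) ⟩
        fun ψ u , flipAt (col C (fun ψ u)) (Inverse.to X x)     ≡⟨ ^ᴱ-last _ _ ⟨
        Φ (u , x) ^ᴱ fromℕ n                                    ∎

  SameOrbit-withinLayer : ∀ u x x′ → SameOrbit E (u , x) (u , x′)
  SameOrbit-withinLayer u x x′ =
    flipAt-connected (λ x x′ → ∀ u → SameOrbit E (u , x) (u , x′))
      (λ x u → SameOrbit-refl E (u , x)) (λ s s′ u → SameOrbit-trans E (s u) (s′ u))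
      (λ j x u → liftAut idAut (flipAt↔ j) (λ v → flipAt-comm j (col C v)) , refl)
      x x′ u

  SameColourOrbit⇒SameOrbit : ∀ {y y′} → SameColourOrbit G C (proj₁ y) (proj₁ y′) → SameOrbit E y y′
  SameColourOrbit⇒SameOrbit {u , x} {_ , x′} (ψ , (π , colour) , refl) =
    SameOrbit-trans E (liftAut ψ (permute↔ π) compat , refl) (SameOrbit-withinLayer (fun ψ u) _ x′)
    where
      compat : ∀ v x → permute π (flipAt (col C v) x) ≡ flipAt (col C (fun ψ v)) (permute π x)
      compat v x = trans (permute-flipAt π (col C v) x) (cong (λ c → flipAt c (permute π x)) (sym (colour v)))

  module _ (isG : IsManiplex G) where

    open IsManiplex isG using (connected)

    layer-invariant : (Θ : Flag E → Flag E) → (∀ j y → Θ (y ^ᴱ inject₁ j) ≡ Θ y ^ᴱ inject₁ j) →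
                      ∀ x u v → proj₂ (Θ (u , x)) ≡ proj₂ (Θ (v , x))
    layer-invariant Θ commutes x u v with connected u v
    ... | W , refl = along u W
      where
        along : ∀ u W → proj₂ (Θ (u , x)) ≡ proj₂ (Θ (walk G u W , x))
        along u []      = refl
        along u (j ∷ W) = begin
          proj₂ (Θ (u , x))                   ≡⟨ layer-below (Θ (u , x)) j ⟨
          proj₂ (Θ (u , x) ^ᴱ inject₁ j)      ≡⟨ cong proj₂ (commutes j (u , x)) ⟨
          proj₂ (Θ ((u , x) ^ᴱ inject₁ j))    ≡⟨ cong (proj₂ ∘ Θ) (^ᴱ-below u x j) ⟩
          proj₂ (Θ (u ^ᴳ j , x))              ≡⟨ along (u ^ᴳ j) W ⟩
          proj₂ (Θ (walk G u (j ∷ W) , x))    ∎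

    restrict : Aut E → Vec Bool ℓ → Aut G
    restrict Φ x = record { fun = ψ ; inv = ψ⁻¹ ; left = ψ⁻¹∘ψ ; right = ψ∘ψ⁻¹ ; preserve = preserveψ }
      where
        ψ : Flag G → Flag G
        ψ u = proj₁ (fun Φ (u , x))

        image-layer : Flag G → Vec Bool ℓ
        image-layer u = proj₂ (fun Φ (u , x))

        ψ⁻¹ : Flag G → Flag G
        ψ⁻¹ v = proj₁ (inv Φ (v , image-layer v))

        ψ⁻¹∘ψ : ∀ u → ψ⁻¹ (ψ u) ≡ u
        ψ⁻¹∘ψ u = begin
          proj₁ (inv Φ (ψ u , image-layer (ψ u))) ≡⟨ cong (λ l → proj₁ (inv Φ (ψ u , l)))
                                                      (layer-invariant (fun Φ) (preserve Φ ∘ inject₁) x (ψ u) u) ⟩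
          proj₁ (inv Φ (fun Φ (u , x)))           ≡⟨ cong proj₁ (left Φ (u , x)) ⟩
          u                                       ∎

        back-in-layer : ∀ v → proj₂ (inv Φ (v , image-layer v)) ≡ x
        back-in-layer v = begin
          proj₂ (inv Φ (v , image-layer v))     ≡⟨ layer-invariant (inv Φ) (preserve (Φ ⁻¹) ∘ inject₁)
                                                                     _ v (ψ v) ⟩
          proj₂ (inv Φ (fun Φ (v , x)))         ≡⟨ cong proj₂ (left Φ (v , x)) ⟩
          x                                     ∎

        ψ∘ψ⁻¹ : ∀ v → ψ (ψ⁻¹ v) ≡ v
        ψ∘ψ⁻¹ v = begin
          proj₁ (fun Φ (ψ⁻¹ v , x))                 ≡⟨ cong (λ l → proj₁ (fun Φ (ψ⁻¹ v , l))) (back-in-layer v) ⟨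
          proj₁ (fun Φ (inv Φ (v , image-layer v))) ≡⟨ cong proj₁ (right Φ _) ⟩
          v                                         ∎

        preserveψ : ∀ j u → ψ (u ^ᴳ j) ≡ ψ u ^ᴳ j
        preserveψ j u = begin
          proj₁ (fun Φ (u ^ᴳ j , x))          ≡⟨ cong (proj₁ ∘ fun Φ) (^ᴱ-below u x j) ⟨
          proj₁ (fun Φ ((u , x) ^ᴱ inject₁ j)) ≡⟨ cong proj₁ (preserve Φ (inject₁ j) (u , x)) ⟩
          proj₁ (fun Φ (u , x) ^ᴱ inject₁ j)   ≡⟨ base-below (fun Φ (u , x)) j ⟩
          ψ u ^ᴳ j                             ∎

    SameOrbit-base : ∀ {y y′} → SameOrbit E y y′ → SameOrbit G (proj₁ y) (proj₁ y′)
    SameOrbit-base {_ , x} (Φ , refl) = restrict Φ x , refl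

    Ext-HasSymType2 : (∀ {u v} → SameOrbit G u v → SameColourOrbit G C u v) →
                      ∀ {I} → HasSymType2 G I → HasSymType2 E (addTop I)
    Ext-HasSymType2 realise {I} ((u , v , u≁v , cover) , types) = two , types′
      where
        lift : ∀ {y y′} → SameOrbit G (proj₁ y) (proj₁ y′) → SameOrbit E y y′
        lift = SameColourOrbit⇒SameOrbit ∘ realise

        x₀ : Vec Bool ℓ
        x₀ = replicate ℓ false

        two : TwoOrbit E
        two = (u , x₀) , (v , x₀) , u≁v ∘ SameOrbit-base , λ y → Sum.map lift lift (cover (proj₁ y))

        types′ : ∀ i → (i ∈ addTop I → ∀ y → SameOrbit E y (y ^ᴱ i))
                     × ((∀ y → SameOrbit E y (y ^ᴱ i)) → i ∈ addTop I)
        types′ i with lastView i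
        ... | below j =
          (λ j∈I y → lift (subst (SameOrbit G (proj₁ y)) (sym (base-below y j))
                             (proj₁ (types j) (inject₁∈addTop⁻ I j j∈I) (proj₁ y)))) ,
          (λ orbits → inject₁∈addTop I j (proj₂ (types j)
             (λ w → subst (SameOrbit G w) (base-below (w , x₀) j) (SameOrbit-base (orbits (w , x₀))))))
        ... | last =
          (λ _ y → subst (SameOrbit E y) (sym (^ᴱ-last (proj₁ y) (proj₂ y)))
                     (SameOrbit-withinLayer (proj₁ y) (proj₂ y) _)) ,
          (λ _ → fromℕ∈addTop I)

module _ {n ℓ k} .{{_ : NonZero k}} {G : Graph n} (C : Colouring G ℓ) (w : RawWeight G k) where

  coverColouring : Colouring (CrossCover G w) ℓ
  coverColouring = record
    { col      = col C ∘ proj₁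
    ; onFacets = λ i z → onFacets C i (proj₁ z)
    ; onto     = λ j → (proj₁ (onto C j) , 0ₖ) , proj₂ (onto C j) }

Covers : ∀ {n k} .{{_ : NonZero k}} {G : Graph n} {w : RawWeight G k} → Aut (CrossCover G w) → Aut G → Set
Covers ψ φ = ∀ z → proj₁ (fun ψ z) ≡ fun φ (proj₁ z)

Covers-ColourPermuting : ∀ {n ℓ k} .{{_ : NonZero k}} {G : Graph n} (C : Colouring G ℓ) (w : RawWeight G k)
                         {ψ : Aut (CrossCover G w)} {φ : Aut G} → Covers ψ φ →
                         ColourPermuting G C φ → ColourPermuting (CrossCover G w) (coverColouring C w) ψ
Covers-ColourPermuting C w covers (π , colour) = π , λ z → trans (cong (col C) (covers z)) (colour (proj₁ z))

crossCover-Ext≅Ext-crossCover : ∀ {n ℓ} (G : Graph n) (C : Colouring G ℓ) (ω : RawWeight G 4) →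
                                CrossCover (Ext G C) (weightC G C ω) ≅ Ext (CrossCover G ω) (coverColouring C ω)
crossCover-Ext≅Ext-crossCover {n} G C ω = record
  { to = to′ ; from = from′ ; from∘to = from∘to′ ; to∘from = to∘from′ ; to-^ = to-^′ }
  where
    B : Graph (suc n)
    B = CrossCover (Ext G C) (weightC G C ω)

    E′ : Graph (suc n)
    E′ = Ext (CrossCover G ω) (coverColouring C ω)

    to′ : Flag B → Flag E′
    to′ ((u , x) , a) = (u , signed x a) , x

    from′ : Flag E′ → Flag B
    from′ ((u , c) , x) = (u , x) , signed x c

    from∘to′ : ∀ y → from′ (to′ y) ≡ y
    from∘to′ ((u , x) , a) = cong ((u , x) ,_) (signed-involutive x a)

    to∘from′ : ∀ y → to′ (from′ y) ≡ y
    to∘from′ ((u , c) , x) = cong (λ c → (u , c) , x) (signed-involutive x c)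

    ^ᴮ-below : ∀ u x a j → _^_ B ((u , x) , a) (inject₁ j) ≡ ((_^_ G u j , x) , signed x (ω j u) -ₖ a)
    ^ᴮ-below u x a j = cong₂ _,_ (^ᴱ-below C u x j) (cong (_-ₖ a) (caseLast-inject₁ j _ _))

    ^ᴮ-last : ∀ u x a → _^_ B ((u , x) , a) (fromℕ n) ≡ ((u , flipAt (col C u) x) , -ₖ a)
    ^ᴮ-last u x a = cong₂ _,_ (^ᴱ-last C u x) (trans (cong (_-ₖ a) (caseLast-fromℕ {n} _ _)) (zero-sub a))

    to-^′ : ∀ i y → to′ (_^_ B y i) ≡ _^_ E′ (to′ y) i
    to-^′ i ((u , x) , a) with lastView i
    ... | below j = begin
      to′ (_^_ B ((u , x) , a) (inject₁ j))           ≡⟨ cong to′ (^ᴮ-below u x a j) ⟩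
      (_^_ G u j , signed x (signed x (ω j u) -ₖ a)) , x ≡⟨ cong (λ c → (_^_ G u j , c) , x) (begin
          signed x (signed x (ω j u) -ₖ a)                ≡⟨ signed-sub x _ a ⟩
          signed x (signed x (ω j u)) -ₖ signed x a       ≡⟨ cong (_-ₖ signed x a) (signed-involutive x _) ⟩
          ω j u -ₖ signed x a                             ∎) ⟩
      (_^_ G u j , ω j u -ₖ signed x a) , x           ≡⟨ ^ᴱ-below (coverColouring C ω) (u , signed x a) x j ⟨
      _^_ E′ (to′ ((u , x) , a)) (inject₁ j)          ∎
    ... | last = begin
      to′ (_^_ B ((u , x) , a) (fromℕ n))                   ≡⟨ cong to′ (^ᴮ-last u x a) ⟩
      (u , signed (flipAt (col C u) x) (-ₖ a)) , flipAt (col C u) x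
                                                           ≡⟨ cong (λ c → (u , c) , flipAt (col C u) x) (begin
          signed (flipAt (col C u) x) (-ₖ a)                  ≡⟨ signed-flipAt (col C u) x (-ₖ a) ⟩
          -ₖ signed x (-ₖ a)                                  ≡⟨ cong -ₖ_ (signed-neg x a) ⟩
          -ₖ (-ₖ signed x a)                                  ≡⟨ neg-involutive _ ⟩
          signed x a                                          ∎) ⟩
      (u , signed x a) , flipAt (col C u) x                 ≡⟨ ^ᴱ-last (coverColouring C ω) (u , signed x a) x ⟨
      _^_ E′ (to′ ((u , x) , a)) (fromℕ n)                 ∎

module _ {n k} .{{_ : NonZero k}} {M : Graph n} (w : RawWeight M k) where

  SameOrbit-intoFibre : Regular M → Consistent M w → ∀ z v → ∃ λ d → SameOrbit (CrossCover M w) z (v , d)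
  SameOrbit-intoFibre regular consistent z v with regular (proj₁ z) v
  ... | φ , φz≡v with consistent φ
  ... | ψ , covers = proj₂ (fun ψ z) , ψ , cong (_, proj₂ (fun ψ z)) (trans (covers z) φz≡v)

module _ {n} {M : Graph n} (ω : RawWeight M 4) (regular : Regular M) (consistent : Consistent M ω) where

  private
    Mω : Graph n
    Mω = CrossCover M ω

  halfTurn : Aut Mω
  halfTurn = record { fun = turn ; inv = turn ; left = turn² ; right = turn² ; preserve = preserveTurn }
    where
      turn : Flag Mω → Flag Mω
      turn z = proj₁ z , proj₂ z +ₖ half
      turn² : ∀ z → turn (turn z) ≡ z
      turn² z = cong (proj₁ z ,_) (+half-involutive (proj₂ z))
      preserveTurn : ∀ j z → turn (_^_ Mω z j) ≡ _^_ Mω (turn z) j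
      preserveTurn j (u , a) = cong (_^_ M u j ,_) (sym (sub-+half (ω j u) a))

  oddShift⇒Regular : ∀ {v b c} → SameOrbit Mω (v , b) (v , c) → OddApart b c → Regular Mω
  oddShift⇒Regular {v} {b} {c} b~c odd z z′ = SameOrbit-trans Mω (toFibre z) (SameOrbit-sym Mω (toFibre z′))
    where
      withinFibre : ∀ d → SameOrbit Mω (v , d) (v , b)
      withinFibre d with oddApart-cover b c odd d
      ... | inj₁ refl                = SameOrbit-refl Mω (v , b)
      ... | inj₂ (inj₁ refl)         = halfTurn , cong (v ,_) (+half-involutive b)
      ... | inj₂ (inj₂ (inj₁ refl))  = SameOrbit-sym Mω b~c
      ... | inj₂ (inj₂ (inj₂ refl))  =
        SameOrbit-trans Mω (halfTurn , cong (v ,_) (+half-involutive c)) (SameOrbit-sym Mω b~c)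

      toFibre : ∀ z → SameOrbit Mω z (v , b)
      toFibre z with SameOrbit-intoFibre ω regular consistent z v
      ... | d , z~vd = SameOrbit-trans Mω z~vd (withinFibre d)

  SameOrbit⇒covered : TwoOrbit Mω → ∀ {z z′} → SameOrbit Mω z z′ →
                      ∃₂ λ ψ φ → Covers {w = ω} ψ φ × fun ψ z ≡ z′
  SameOrbit⇒covered two {u , a} {v , b} z~z′ with regular u v
  ... | φ , refl with consistent φ
  ... | χ , covers with parity-cases b (proj₂ (fun χ (u , a)))
  ... | inj₁ c≡b           = χ , φ , covers , cong₂ _,_ (covers (u , a)) c≡b
  ... | inj₂ (inj₁ c+half≡b)  = χ ⨾ halfTurn , φ , covers , cong₂ _,_ (covers (u , a)) c+half≡b
  ... | inj₂ (inj₂ odd)    = ⊥-elim (TwoOrbit⇒¬Regular Mω two (oddShift⇒Regular b~c odd))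
    where
      b~c : SameOrbit Mω (fun φ u , b) (fun φ u , proj₂ (fun χ (u , a)))
      b~c = SameOrbit-trans Mω (SameOrbit-sym Mω z~z′) (χ , cong (_, proj₂ (fun χ (u , a))) (covers (u , a)))

  SameOrbit⇒SameColourOrbit : ∀ {ℓ} (C : Colouring M ℓ) → AutInvariant M C → TwoOrbit Mω →
                              ∀ {z z′} → SameOrbit Mω z z′ → SameColourOrbit Mω (coverColouring C ω) z z′
  SameOrbit⇒SameColourOrbit C invariant two z~z′ with SameOrbit⇒covered two z~z′
  ... | ψ , φ , covers , ψz≡z′ = ψ , Covers-ColourPermuting C ω {ψ} {φ} covers (invariant φ) , ψz≡z′

lemma5p9 : ∀ {n ℓ : ℕ} (M : Graph n) → IsManiplex M
           → (ω : RawWeight M 4) → IsWeight M ω → ProperPair M ω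
           → (C : Colouring M ℓ) → AutInvariant M C
           → (I : Subset n) → HasSymType2 (CrossCover M ω) I
           → IsManiplex (CrossCover (Ext M C) (weightC M C ω))
             × HasSymType2 (CrossCover (Ext M C) (weightC M C ω)) (addTop I)
lemma5p9 {n} {ℓ} M _ ω _ (regular , _ , (isMω , _) , consistent) C invariant I symType =
    ≅-IsManiplex untwist (Ext-IsManiplex C′ isMω)
  , ≅-HasSymType2 untwist (Ext-HasSymType2 C′ isMω realised symType)
  where
    C′ : Colouring (CrossCover M ω) ℓ
    C′ = coverColouring C ω

    untwist : Ext (CrossCover M ω) C′ ≅ CrossCover (Ext M C) (weightC M C ω)
    untwist = ≅-sym (crossCover-Ext≅Ext-crossCover M C ω)

    realised : ∀ {z z′} → SameOrbit (CrossCover M ω) z z′ → SameColourOrbit (CrossCover M ω) C′ z z′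
    realised = SameOrbit⇒SameColourOrbit ω regular consistent C invariant (proj₁ symType)
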